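{- Let $L < N \le 2L$ be positive integers, let $\boldsymbol\xi_1, \dots, \boldsymbol\xi_L \in F_N$, let $\Xi = (\boldsymbol\xi_1\ \cdots\ \boldsymbol\xi_L)$, and let $Y = \Xi^T = (\boldsymbol y_1\ \cdots\ \boldsymbol y_N) = (y_{\ell n})$ with columns $\boldsymbol y_n \in \mathbb{Z}^L$, all nonzero. For $\ell = 1,\dots,L$ let $S(\ell) = \{n : |y_{\ell n}| = 1\}$; for $A \subseteq \{1,\dots,N\}$ let $\eta(A) = \bigcup_{\ell:\, S(\ell)\cap A\ne\emptyset} S(\ell)$, and $\mathcal P = \{A : \eta(A) = A\}$. Let $A$ be a nonempty subset of $\{1,\dots,N\}$. Then the following are equivalent: (i) $A$ is minimal; (ii) the subgroup $\langle \boldsymbol y_n : n \in A\rangle \subseteq \mathbb{Z}^L$ has rank $|A| - 1$, and for every nonempty $B \subseteq A$ with $|B| \le |A| - 1$ the vectors $\{\boldsymbol y_n : n \in B\}$ are linearly independent.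
   Context: $F_N = \{\boldsymbol e_m - \boldsymbol e_n : m\ne n\}$ with $\boldsymbol e_m$ the standard basis of $\mathbb{R}^N$. A nonempty set $A \in \mathcal P$ is minimal if for every nonempty subset $B \subseteq A$ with $B \ne A$ we have $\eta(B) \ne B$. -}

module Defs where

open import Data.Nat as ℕ using (ℕ; zero; suc)
open import Data.Integer as ℤ using (ℤ; _+_; _-_; _*_; ∣_∣)
open import Data.Fin using (Fin; zero; suc)
open import Data.Fin.Subset using (Subset; _∈_; _∉_)
open import Data.Product using (Σ; ∃; ∃-syntax; _×_)
open import Relation.Binary.PropositionalEquality using (_≡_; _≢_)
open import Relation.Nullary using (¬_)
open import Relation.Nullary.Decidable using (⌊_⌋)
import Data.Fin.Properties as FinP

Vecℤ : ℕ → Set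
Vecℤ k = Fin k → ℤ

Σℤ : ∀ {n} → (Fin n → ℤ) → ℤ
Σℤ {zero}  f = ℤ.0ℤ
Σℤ {suc n} f = f zero + Σℤ (λ i → f (suc i))

e : ∀ {N} → Fin N → Vecℤ N
e m k = if ⌊ m FinP.≟ k ⌋ then ℤ.1ℤ else ℤ.0ℤ
  where
  open import Data.Bool using (if_then_else_)

InF : ∀ {N} → Vecℤ N → Set
InF {N} v = Σ (Fin N) λ m → Σ (Fin N) λ n → m ≢ n × (∀ k → v k ≡ e m k - e n k)

-- Ξ = (ξ_1 ⋯ ξ_L), ξ ℓ : Vecℤ N.  Y = Ξᵀ, column y_n ∈ ℤ^L, y_{ℓ n} = (ξ_ℓ)_n
col : ∀ {L N} → (Fin L → Vecℤ N) → Fin N → Vecℤ L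
col ξ n ℓ = ξ ℓ n

InS : ∀ {L N} → (Fin L → Vecℤ N) → Fin L → Fin N → Set
InS ξ ℓ n = ∣ col ξ n ℓ ∣ ≡ 1

Inη : ∀ {L N} → (Fin L → Vecℤ N) → Subset N → Fin N → Set
Inη {L} {N} ξ A n = Σ (Fin L) λ ℓ → (Σ (Fin N) λ m → InS ξ ℓ m × m ∈ A) × InS ξ ℓ n

InP : ∀ {L N} → (Fin L → Vecℤ N) → Subset N → Set
InP {L} {N} ξ A = ∀ n → (Inη ξ A n → n ∈ A) × (n ∈ A → Inη ξ A n)

open import Data.Fin.Subset using (Nonempty; _⊆_)

Minimal : ∀ {L N} → (Fin L → Vecℤ N) → Subset N → Set
Minimal ξ A = Nonempty A × InP ξ A ×
  (∀ B → B ⊆ A → Nonempty B → B ≢ A → ¬ InP ξ B)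

LinIndep : ∀ {k L} → (Fin k → Vecℤ L) → Set
LinIndep {k} {L} w = ∀ (c : Fin k → ℤ) →
  (∀ ℓ → Σℤ (λ i → c i * w i ℓ) ≡ ℤ.0ℤ) → ∀ i → c i ≡ ℤ.0ℤ

LinIndepOn : ∀ {L N} → (Fin L → Vecℤ N) → Subset N → Set
LinIndepOn {L} {N} ξ B = ∀ (c : Fin N → ℤ) → (∀ n → n ∉ B → c n ≡ ℤ.0ℤ) →
  (∀ ℓ → Σℤ (λ n → c n * col ξ n ℓ) ≡ ℤ.0ℤ) → ∀ n → c n ≡ ℤ.0ℤ

InSpan : ∀ {L N} → (Fin L → Vecℤ N) → Subset N → Vecℤ L → Set
InSpan {L} {N} ξ A v = Σ (Fin N → ℤ) λ c → (∀ n → n ∉ A → c n ≡ ℤ.0ℤ) ×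
  (∀ ℓ → v ℓ ≡ Σℤ (λ n → c n * col ξ n ℓ))

HasRank : ∀ {L} → (Vecℤ L → Set) → ℕ → Set
HasRank {L} G r =
  (Σ (Fin r → Vecℤ L) λ w → (∀ i → G (w i)) × LinIndep w) ×
  (∀ (w : Fin (suc r) → Vecℤ L) → (∀ i → G (w i)) → ¬ LinIndep w)

{-# OPTIONS --safe #-}
-- The vectors ξ_ℓ = e_m − e_n are the edges of a graph on {1, …, N}, and y_n is the column of its
-- incidence matrix at the vertex n. A coefficient vector is a relation among the y_n exactly when
-- it is constant along every edge, and η(A) = A says that A is closed under the edges. Both (i)
-- and (ii) amount to: A is closed and every a ∈ A lies in every nonempty closed subset of A.
-- Indeed, the indicator of a closed D ⊂ A missing a is a relation among fewer than |A| columns,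
-- while a level set of a relation supported on A is closed; so the relations supported on such an
-- A are the multiples of its indicator. Hence the columns of A without one vertex form a basis of
-- ⟨y_n : n ∈ A⟩, and the columns of A are dependent, which is impossible if an edge leaves A.
module Submission where

open import Defs

module Incidence where

  open import Data.Nat using (ℕ; zero; suc; _<_; _≤_; _∸_; pred)
  import Data.Nat.Properties as ℕP
  open import Data.Integer as ℤ using (ℤ; 0ℤ; 1ℤ; -1ℤ; _+_; _-_; _*_; -_)
  import Data.Integer.Properties as ℤP
  open import Data.Integer.Tactic.RingSolver using (solve-∀)
  open import Algebra.Properties.Semiring.Sum ℤP.+-*-semiring
    using (sum; sum-cong-≗; sum-replicate-zero; ∑-distrib-+; ∑-comm; *-distribˡ-sum)
  open import Data.Fin using (Fin; zero; suc; punchIn; punchOut)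
  import Data.Fin.Properties as FinP
  open import Data.Fin.Subset using (Subset; _∈_; _∉_; _⊆_; ⁅_⁆; ∣_∣; Nonempty; inside; outside)
    renaming (_-_ to _∖_)
  open import Data.Fin.Subset.Properties
    using (_∈?_; ⊆-refl; ⊆-antisym; p─q⊆p; p─⊥≡p; x∈p∧x≢y⇒x∈p-y; p⊆q⇒∣p∣≤∣q∣; p⊂q⇒∣p∣<∣q∣)
  open import Data.Vec using ([]; _∷_; here; there; tabulate)
  open import Data.Vec.Properties using (lookup⇒[]=; []=⇒lookup; lookup∘tabulate)
  open import Data.Bool using (true)
  open import Data.Product using (Σ; ∃; _×_; _,_; proj₁; proj₂)
  open import Data.Sum using (_⊎_; inj₁; inj₂)
  open import Function.Base using (_∘_)
  open import Relation.Nullary using (¬_; yes; no; contradiction)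
  open import Relation.Nullary.Decidable using (⌊_⌋; ¬?; _×-dec_)
  open import Relation.Binary.PropositionalEquality
  open ≡-Reasoning

  Σℤ≡sum : ∀ {n} (f : Fin n → ℤ) → Σℤ f ≡ sum f
  Σℤ≡sum {zero}  f = refl
  Σℤ≡sum {suc n} f = cong (f zero +_) (Σℤ≡sum (f ∘ suc))

  Σℤ-cong : ∀ {n} {f g : Fin n → ℤ} → (∀ i → f i ≡ g i) → Σℤ f ≡ Σℤ g
  Σℤ-cong {f = f} {g} f≗g = trans (Σℤ≡sum f) (trans (sum-cong-≗ f≗g) (sym (Σℤ≡sum g)))

  Σℤ-zero : ∀ {n} (f : Fin n → ℤ) → (∀ i → f i ≡ 0ℤ) → Σℤ f ≡ 0ℤ
  Σℤ-zero {n} f f≗0 = trans (Σℤ≡sum f) (trans (sum-cong-≗ f≗0) (sum-replicate-zero n))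

  Σℤ-+ : ∀ {n} (f g : Fin n → ℤ) → Σℤ (λ i → f i + g i) ≡ Σℤ f + Σℤ g
  Σℤ-+ f g = begin
    Σℤ (λ i → f i + g i)  ≡⟨ Σℤ≡sum (λ i → f i + g i) ⟩
    sum (λ i → f i + g i) ≡⟨ ∑-distrib-+ f g ⟩
    sum f + sum g         ≡⟨ sym (cong₂ _+_ (Σℤ≡sum f) (Σℤ≡sum g)) ⟩
    Σℤ f + Σℤ g           ∎

  Σℤ-*ˡ : ∀ {n} (a : ℤ) (f : Fin n → ℤ) → Σℤ (λ i → a * f i) ≡ a * Σℤ f
  Σℤ-*ˡ a f = begin
    Σℤ (λ i → a * f i)  ≡⟨ Σℤ≡sum (λ i → a * f i) ⟩
    sum (λ i → a * f i) ≡⟨ sym (*-distribˡ-sum a f) ⟩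
    a * sum f           ≡⟨ cong (a *_) (sym (Σℤ≡sum f)) ⟩
    a * Σℤ f            ∎

  Σℤ-- : ∀ {n} (f g : Fin n → ℤ) → Σℤ (λ i → f i - g i) ≡ Σℤ f - Σℤ g
  Σℤ-- f g = begin
    Σℤ (λ i → f i - g i)        ≡⟨ Σℤ-+ f (λ i → - g i) ⟩
    Σℤ f + Σℤ (λ i → - g i)     ≡⟨ cong (Σℤ f +_) (Σℤ-cong (λ i → sym (ℤP.-1*i≡-i (g i)))) ⟩
    Σℤ f + Σℤ (λ i → -1ℤ * g i) ≡⟨ cong (Σℤ f +_) (trans (Σℤ-*ˡ -1ℤ g) (ℤP.-1*i≡-i (Σℤ g))) ⟩
    Σℤ f - Σℤ g                 ∎

  Σℤ-comm : ∀ {m n} (f : Fin m → Fin n → ℤ) →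
            Σℤ (λ i → Σℤ (λ j → f i j)) ≡ Σℤ (λ j → Σℤ (λ i → f i j))
  Σℤ-comm f = begin
    Σℤ (λ i → Σℤ (λ j → f i j))   ≡⟨ Σℤ-cong (λ i → Σℤ≡sum (f i)) ⟩
    Σℤ (λ i → sum (λ j → f i j))  ≡⟨ Σℤ≡sum (λ i → sum (f i)) ⟩
    sum (λ i → sum (λ j → f i j)) ≡⟨ ∑-comm f ⟩
    sum (λ j → sum (λ i → f i j)) ≡⟨ sym (Σℤ≡sum (λ j → sum (λ i → f i j))) ⟩
    Σℤ (λ j → sum (λ i → f i j))  ≡⟨ sym (Σℤ-cong (λ j → Σℤ≡sum (λ i → f i j))) ⟩
    Σℤ (λ j → Σℤ (λ i → f i j))   ∎

  e-suc : ∀ {n} (m k : Fin n) → e (suc m) (suc k) ≡ e m k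
  e-suc m k with m FinP.≟ k
  ... | yes _ = refl
  ... | no  _ = refl

  e-diag : ∀ {n} (m : Fin n) → e m m ≡ 1ℤ
  e-diag zero    = refl
  e-diag (suc m) = trans (e-suc m m) (e-diag m)

  e-off : ∀ {n} {m k : Fin n} → m ≢ k → e m k ≡ 0ℤ
  e-off {m = zero}  {zero}  m≢k = contradiction refl m≢k
  e-off {m = zero}  {suc k} m≢k = refl
  e-off {m = suc m} {zero}  m≢k = refl
  e-off {m = suc m} {suc k} m≢k = trans (e-suc m k) (e-off (m≢k ∘ cong suc))

  Σℤ-e : ∀ {n} (f : Fin n → ℤ) (m : Fin n) → Σℤ (λ k → f k * e m k) ≡ f m
  Σℤ-e {suc n} f zero = begin
    f zero * 1ℤ + Σℤ (λ k → f (suc k) * 0ℤ) ≡⟨ cong₂ _+_ (ℤP.*-identityʳ (f zero))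
                                                 (Σℤ-zero _ (λ k → ℤP.*-zeroʳ (f (suc k)))) ⟩
    f zero + 0ℤ                             ≡⟨ ℤP.+-identityʳ (f zero) ⟩
    f zero                                  ∎
  Σℤ-e {suc n} f (suc m) = begin
    f zero * 0ℤ + Σℤ (λ k → f (suc k) * e (suc m) (suc k)) ≡⟨ cong₂ _+_ (ℤP.*-zeroʳ (f zero))
                                                                (Σℤ-cong (λ k → cong (f (suc k) *_) (e-suc m k))) ⟩
    0ℤ + Σℤ (λ k → f (suc k) * e m k)                      ≡⟨ ℤP.+-identityˡ _ ⟩
    Σℤ (λ k → f (suc k) * e m k)                           ≡⟨ Σℤ-e (f ∘ suc) m ⟩
    f (suc m)                                              ∎

  LinComb : ∀ {k L} → (Fin k → Vecℤ L) → (Fin k → ℤ) → Vecℤ L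
  LinComb w c ℓ = Σℤ (λ i → c i * w i ℓ)

  NontrivialRelation : ∀ {k L} → (Fin k → Vecℤ L) → Set
  NontrivialRelation w = Σ (_ → ℤ) λ c → (∃ λ i → c i ≢ 0ℤ) × (∀ ℓ → LinComb w c ℓ ≡ 0ℤ)

  NontrivialRelation⇒¬LinIndep : ∀ {k L} {w : Fin k → Vecℤ L} → NontrivialRelation w → ¬ LinIndep w
  NontrivialRelation⇒¬LinIndep (c , (i , cᵢ≢0) , rel) indep = cᵢ≢0 (indep c rel i)

  zero-row⇒relation : ∀ {n r} (M : Fin (suc n) → Vecℤ r) → (∀ j → M zero j ≡ 0ℤ) → NontrivialRelation M
  zero-row⇒relation M row₀≡0 = c , (zero , λ ()) , rel
    where
    c : Fin _ → ℤ
    c zero    = 1ℤ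
    c (suc i) = 0ℤ
    rel : ∀ j → LinComb M c j ≡ 0ℤ
    rel j = cong₂ _+_ (trans (ℤP.*-identityˡ (M zero j)) (row₀≡0 j))
                      (Σℤ-zero _ (λ i → ℤP.*-zeroˡ (M (suc i) j)))

  -- One step of fraction-free Gaussian elimination: clear column j₀ of rows 1..n against the
  -- pivot M 0 j₀, then drop that column.
  eliminate : ∀ {n r} → (Fin (suc n) → Vecℤ (suc r)) → Fin (suc r) → Fin n → Vecℤ r
  eliminate M j₀ i j = M zero j₀ * M (suc i) (punchIn j₀ j) - M zero (punchIn j₀ j) * M (suc i) j₀

  relation-of-eliminate : ∀ {n r} (M : Fin (suc n) → Vecℤ (suc r)) (j₀ : Fin (suc r)) →
    M zero j₀ ≢ 0ℤ → NontrivialRelation (eliminate M j₀) → NontrivialRelation M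
  relation-of-eliminate M j₀ p≢0 (x , (i₁ , xᵢ₁≢0) , rel) = c , (suc i₁ , c≢0) , c-rel
    where
    p = M zero j₀
    S = LinComb (M ∘ suc) x j₀
    c : Fin _ → ℤ
    c zero    = - S
    c (suc i) = p * x i
    c≢0 : p * x i₁ ≢ 0ℤ
    c≢0 px≡0 with ℤP.i*j≡0⇒i≡0∨j≡0 p px≡0
    ... | inj₁ p≡0 = p≢0 p≡0
    ... | inj₂ x≡0 = xᵢ₁≢0 x≡0
    tail-sum : ∀ j → Σℤ (λ i → c (suc i) * M (suc i) j) ≡ p * LinComb (M ∘ suc) x j
    tail-sum j = trans (Σℤ-cong (λ i → ℤP.*-assoc p (x i) (M (suc i) j))) (Σℤ-*ˡ p (λ i → x i * M (suc i) j))
    c-rel-off : ∀ j → LinComb M c (punchIn j₀ j) ≡ 0ℤ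
    c-rel-off j = begin
      - S * m + Σℤ (λ i → c (suc i) * M (suc i) j⁺)  ≡⟨ cong (- S * m +_) (tail-sum j⁺) ⟩
      - S * m + p * A                               ≡⟨ rearrange S m p A ⟩
      p * A - m * S                                 ≡⟨ cong₂ _-_ (Σℤ-*ˡ p a) (Σℤ-*ˡ m b) ⟨
      Σℤ (λ i → p * a i) - Σℤ (λ i → m * b i)       ≡⟨ Σℤ-- (λ i → p * a i) (λ i → m * b i) ⟨
      Σℤ (λ i → p * a i - m * b i)                  ≡⟨ Σℤ-cong (λ i → distrib (x i) p (M (suc i) j⁺) m (M (suc i) j₀)) ⟨
      LinComb (eliminate M j₀) x j                  ≡⟨ rel j ⟩
      0ℤ                                            ∎
      where
      j⁺ = punchIn j₀ j
      m = M zero j⁺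
      a = λ i → x i * M (suc i) j⁺
      b = λ i → x i * M (suc i) j₀
      A = LinComb (M ∘ suc) x j⁺
      rearrange : ∀ S m p A → - S * m + p * A ≡ p * A - m * S
      rearrange = solve-∀
      distrib : ∀ x p a m b → x * (p * a - m * b) ≡ p * (x * a) - m * (x * b)
      distrib = solve-∀
    c-rel : ∀ j → LinComb M c j ≡ 0ℤ
    c-rel j with j₀ FinP.≟ j
    ... | yes refl = trans (cong (- S * p +_) (tail-sum j₀)) (cancel S p)
      where
      cancel : ∀ S p → - S * p + p * S ≡ 0ℤ
      cancel = solve-∀
    ... | no j₀≢j = subst (λ j → LinComb M c j ≡ 0ℤ) (FinP.punchIn-punchOut j₀≢j) (c-rel-off (punchOut j₀≢j))

  wide⇒relation : ∀ {n r} → r < n → (M : Fin n → Vecℤ r) → NontrivialRelation M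
  wide⇒relation {zero} () M
  wide⇒relation {suc n} {r} r<n M with FinP.all? (λ j → M zero j ℤ.≟ 0ℤ)
  ... | yes row₀≡0 = zero-row⇒relation M row₀≡0
  wide⇒relation {suc n} {zero} r<n M | no row₀≢0 = contradiction (λ ()) row₀≢0
  wide⇒relation {suc n} {suc r} r<n M | no row₀≢0 =
    let (j₀ , p≢0) = FinP.¬∀⟶∃¬ _ _ (λ j → M zero j ℤ.≟ 0ℤ) row₀≢0
    in relation-of-eliminate M j₀ p≢0 (wide⇒relation (ℕP.≤-pred r<n) (eliminate M j₀))

  InSpanOf : ∀ {k L} → (Fin k → Vecℤ L) → Vecℤ L → Set
  InSpanOf g v = Σ (_ → ℤ) λ d → ∀ ℓ → v ℓ ≡ LinComb g d ℓ

  spanned-by-fewer⇒¬LinIndep : ∀ {k n L} → k < n → (g : Fin k → Vecℤ L) (w : Fin n → Vecℤ L) →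
                               (∀ i → InSpanOf g (w i)) → ¬ LinIndep w
  spanned-by-fewer⇒¬LinIndep k<n g w w∈⟨g⟩ =
    NontrivialRelation⇒¬LinIndep (x , x≢0 , w-rel)
    where
    d = λ i → proj₁ (w∈⟨g⟩ i)
    d-rel = wide⇒relation k<n d
    x = proj₁ d-rel
    x≢0 = proj₁ (proj₂ d-rel)
    w-rel : ∀ ℓ → LinComb w x ℓ ≡ 0ℤ
    w-rel ℓ = begin
      Σℤ (λ i → x i * w i ℓ)                          ≡⟨ Σℤ-cong (λ i → cong (x i *_) (proj₂ (w∈⟨g⟩ i) ℓ)) ⟩
      Σℤ (λ i → x i * Σℤ (λ j → d i j * g j ℓ))       ≡⟨ Σℤ-cong (λ i → Σℤ-*ˡ (x i) (λ j → d i j * g j ℓ)) ⟨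
      Σℤ (λ i → Σℤ (λ j → x i * (d i j * g j ℓ)))     ≡⟨ Σℤ-comm (λ i j → x i * (d i j * g j ℓ)) ⟩
      Σℤ (λ j → Σℤ (λ i → x i * (d i j * g j ℓ)))     ≡⟨ Σℤ-cong (λ j → Σℤ-cong (λ i → reassoc (x i) (d i j) (g j ℓ))) ⟩
      Σℤ (λ j → Σℤ (λ i → g j ℓ * (x i * d i j)))     ≡⟨ Σℤ-cong (λ j → Σℤ-*ˡ (g j ℓ) (λ i → x i * d i j)) ⟩
      Σℤ (λ j → g j ℓ * LinComb d x j)                ≡⟨ Σℤ-zero _ (λ j → trans (cong (g j ℓ *_) (proj₂ (proj₂ d-rel) j))
                                                                              (ℤP.*-zeroʳ (g j ℓ))) ⟩
      0ℤ                                              ∎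
      where
      reassoc : ∀ x d g → x * (d * g) ≡ g * (x * d)
      reassoc = solve-∀

  enum : ∀ {N} (A : Subset N) → Fin ∣ A ∣ → Fin N
  enum (inside  ∷ A) zero    = zero
  enum (inside  ∷ A) (suc i) = suc (enum A i)
  enum (outside ∷ A) i       = suc (enum A i)

  enum-∈ : ∀ {N} (A : Subset N) i → enum A i ∈ A
  enum-∈ (inside  ∷ A) zero    = here
  enum-∈ (inside  ∷ A) (suc i) = there (enum-∈ A i)
  enum-∈ (outside ∷ A) i       = there (enum-∈ A i)

  SupportedOn : ∀ {N} → Subset N → (Fin N → ℤ) → Set
  SupportedOn A c = ∀ n → n ∉ A → c n ≡ 0ℤ

  SupportedOn-tail : ∀ {N s} {A : Subset N} {c : Fin (suc N) → ℤ} →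
                     SupportedOn (s ∷ A) c → SupportedOn A (c ∘ suc)
  SupportedOn-tail supp n n∉A = supp (suc n) λ { (there n∈A) → n∉A n∈A }

  Σℤ-enum : ∀ {N} (A : Subset N) {c : Fin N → ℤ} → SupportedOn A c → (f : Fin N → ℤ) →
            Σℤ (λ n → c n * f n) ≡ Σℤ (λ j → c (enum A j) * f (enum A j))
  Σℤ-enum []            supp f = refl
  Σℤ-enum (inside  ∷ A) {c} supp f =
    cong (c zero * f zero +_) (Σℤ-enum A (SupportedOn-tail supp) (f ∘ suc))
  Σℤ-enum (outside ∷ A) supp f =
    trans (cong₂ _+_ (cong (_* f zero) (supp zero λ ())) (Σℤ-enum A (SupportedOn-tail supp) (f ∘ suc)))
          (ℤP.+-identityˡ _)

  lift : ∀ {N} (A : Subset N) → (Fin ∣ A ∣ → ℤ) → Fin N → ℤ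
  lift (inside  ∷ A) d zero    = d zero
  lift (inside  ∷ A) d (suc n) = lift A (d ∘ suc) n
  lift (outside ∷ A) d zero    = 0ℤ
  lift (outside ∷ A) d (suc n) = lift A d n

  lift-supported : ∀ {N} (A : Subset N) d → SupportedOn A (lift A d)
  lift-supported (inside  ∷ A) d zero    n∉A = contradiction here n∉A
  lift-supported (inside  ∷ A) d (suc n) n∉A = lift-supported A (d ∘ suc) n (n∉A ∘ there)
  lift-supported (outside ∷ A) d zero    n∉A = refl
  lift-supported (outside ∷ A) d (suc n) n∉A = lift-supported A d n (n∉A ∘ there)

  lift-enum : ∀ {N} (A : Subset N) d i → lift A d (enum A i) ≡ d i
  lift-enum (inside  ∷ A) d zero    = refl
  lift-enum (inside  ∷ A) d (suc i) = lift-enum A (d ∘ suc) i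
  lift-enum (outside ∷ A) d i       = lift-enum A d i

  x∈p⇒suc∣p-x∣≡∣p∣ : ∀ {n} {x : Fin n} {p : Subset n} → x ∈ p → suc ∣ p ∖ x ∣ ≡ ∣ p ∣
  x∈p⇒suc∣p-x∣≡∣p∣ {x = zero}  {inside  ∷ p} here        = cong (suc ∘ ∣_∣) (p─⊥≡p p)
  x∈p⇒suc∣p-x∣≡∣p∣ {x = suc x} {inside  ∷ p} (there x∈p) = cong suc (x∈p⇒suc∣p-x∣≡∣p∣ x∈p)
  x∈p⇒suc∣p-x∣≡∣p∣ {x = suc x} {outside ∷ p} (there x∈p) = x∈p⇒suc∣p-x∣≡∣p∣ x∈p

  x∈p⇒suc[pred∣p∣]≡∣p∣ : ∀ {n} {x : Fin n} {p : Subset n} → x ∈ p → suc (pred ∣ p ∣) ≡ ∣ p ∣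
  x∈p⇒suc[pred∣p∣]≡∣p∣ x∈p = subst (λ m → suc (pred m) ≡ m) (x∈p⇒suc∣p-x∣≡∣p∣ x∈p) refl

  ⊆⊎∃∈∧∉ : ∀ {N} (A B : Subset N) → A ⊆ B ⊎ ∃ λ a → a ∈ A × a ∉ B
  ⊆⊎∃∈∧∉ A B with FinP.any? (λ a → (a ∈? A) ×-dec ¬? (a ∈? B))
  ... | yes witness = inj₂ witness
  ... | no  none    = inj₁ λ {a} a∈A → case-∈ a a∈A
    where
    case-∈ : ∀ a → a ∈ A → a ∈ B
    case-∈ a a∈A with a ∈? B
    ... | yes a∈B = a∈B
    ... | no  a∉B = contradiction (a , a∈A , a∉B) none

  indicator : ∀ {N} → Subset N → Fin N → ℤ
  indicator D k with k ∈? D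
  ... | yes _ = 1ℤ
  ... | no  _ = 0ℤ

  indicator-∈ : ∀ {N} {D : Subset N} {k} → k ∈ D → indicator D k ≡ 1ℤ
  indicator-∈ {D = D} {k} k∈D with k ∈? D
  ... | yes _   = refl
  ... | no  k∉D = contradiction k∈D k∉D

  indicator-∉ : ∀ {N} {D : Subset N} {k} → k ∉ D → indicator D k ≡ 0ℤ
  indicator-∉ {D = D} {k} k∉D with k ∈? D
  ... | yes k∈D = contradiction k∈D k∉D
  ... | no  _   = refl

  level-set : ∀ {N} → (Fin N → ℤ) → ℤ → Subset N
  level-set c v = tabulate (λ k → ⌊ c k ℤ.≟ v ⌋)

  ∈-level-set : ∀ {N} (c : Fin N → ℤ) {v k} → c k ≡ v → k ∈ level-set c v
  ∈-level-set c {v} {k} ck≡v = lookup⇒[]= k _ (trans (lookup∘tabulate _ k) (is-true (c k ℤ.≟ v)))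
    where
    is-true : (d : _) → ⌊ d ⌋ ≡ true
    is-true (yes _)  = refl
    is-true (no ck≢v) = contradiction ck≡v ck≢v

  level-set-∈ : ∀ {N} (c : Fin N → ℤ) {v k} → k ∈ level-set c v → c k ≡ v
  level-set-∈ c {v} {k} k∈ = from-true (c k ℤ.≟ v) (trans (sym (lookup∘tabulate _ k)) ([]=⇒lookup k∈))
    where
    from-true : (d : _) → ⌊ d ⌋ ≡ true → c k ≡ v
    from-true (yes ck≡v) _ = ck≡v
    from-true (no _)    ()

  Dependency : ∀ {L N} → (Fin L → Vecℤ N) → (Fin N → ℤ) → Set
  Dependency ξ c = ∀ ℓ → LinComb (col ξ) c ℓ ≡ 0ℤ

  module _ {L N} (ξ : Fin L → Vecℤ N) where

    InSpan-col : ∀ {A m} → m ∈ A → InSpan ξ A (col ξ m)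
    InSpan-col {A} {m} m∈A = e m , supp , λ ℓ → sym (begin
      Σℤ (λ n → e m n * col ξ n ℓ) ≡⟨ Σℤ-cong (λ n → ℤP.*-comm (e m n) (col ξ n ℓ)) ⟩
      Σℤ (λ n → col ξ n ℓ * e m n) ≡⟨ Σℤ-e (λ n → col ξ n ℓ) m ⟩
      col ξ m ℓ                    ∎)
      where
      supp : SupportedOn A (e m)
      supp n n∉A = e-off (λ m≡n → n∉A (subst (_∈ A) m≡n m∈A))

    InSpan⇒InSpanOf-enum : ∀ {A v} → InSpan ξ A v → InSpanOf (col ξ ∘ enum A) v
    InSpan⇒InSpanOf-enum {A} (c , supp , v≡) =
      c ∘ enum A , λ ℓ → trans (v≡ ℓ) (Σℤ-enum A supp (λ n → col ξ n ℓ))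

    LinIndepOn⇒LinIndep-enum : ∀ {B} → LinIndepOn ξ B → LinIndep (col ξ ∘ enum B)
    LinIndepOn⇒LinIndep-enum {B} indep d d-rel i = begin
      d i                 ≡⟨ lift-enum B d i ⟨
      lift B d (enum B i) ≡⟨ indep (lift B d) (lift-supported B d) lift-rel (enum B i) ⟩
      0ℤ                  ∎
      where
      lift-rel : Dependency ξ (lift B d)
      lift-rel ℓ = begin
        LinComb (col ξ) (lift B d) ℓ                           ≡⟨ Σℤ-enum B (lift-supported B d) (λ n → col ξ n ℓ) ⟩
        Σℤ (λ j → lift B d (enum B j) * col ξ (enum B j) ℓ)   ≡⟨ Σℤ-cong (λ j → cong (_* col ξ (enum B j) ℓ) (lift-enum B d j)) ⟩
        LinComb (col ξ ∘ enum B) d ℓ                           ≡⟨ d-rel ℓ ⟩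
        0ℤ                                                     ∎

    independent-columns : ∀ {A B} → B ⊆ A → LinIndepOn ξ B →
      Σ (Fin ∣ B ∣ → Vecℤ L) λ w → (∀ i → InSpan ξ A (w i)) × LinIndep w
    independent-columns {B = B} B⊆A indep =
      col ξ ∘ enum B , (λ i → InSpan-col (B⊆A (enum-∈ B i))) , LinIndepOn⇒LinIndep-enum indep

    -- A dependency through a with coefficient 1 expresses y_a through the other columns of A.
    InSpan-remove : ∀ {A a d v} → Dependency ξ d → SupportedOn A d → d a ≡ 1ℤ →
                    InSpan ξ A v → InSpan ξ (A ∖ a) v
    InSpan-remove {A} {a} {d} {v} d-rel d-supp da≡1 (c , c-supp , v≡) = c′ , c′-supp , v≡′
      where
      c′ : Fin N → ℤ
      c′ n = c n - c a * d n
      c′-supp : SupportedOn (A ∖ a) c′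
      c′-supp n n∉A∖a with n FinP.≟ a | n ∈? A
      ... | yes refl | _       = trans (cong (λ z → c n - c n * z) da≡1) (self-cancel (c n))
        where
        self-cancel : ∀ x → x - x * 1ℤ ≡ 0ℤ
        self-cancel = solve-∀
      ... | no n≢a   | yes n∈A = contradiction (x∈p∧x≢y⇒x∈p-y n∈A n≢a) n∉A∖a
      ... | no _     | no n∉A  = trans (cong₂ (λ x y → x - c a * y) (c-supp n n∉A) (d-supp n n∉A))
                                       (cong (λ z → 0ℤ - z) (ℤP.*-zeroʳ (c a)))
      v≡′ : ∀ ℓ → v ℓ ≡ LinComb (col ξ) c′ ℓ
      v≡′ ℓ = sym (begin
        Σℤ (λ n → (c n - c a * d n) * y n)          ≡⟨ Σℤ-cong (λ n → distrib (c n) (c a) (d n) (y n)) ⟩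
        Σℤ (λ n → c n * y n - c a * (d n * y n))    ≡⟨ Σℤ-- (λ n → c n * y n) (λ n → c a * (d n * y n)) ⟩
        Σc - Σℤ (λ n → c a * (d n * y n))           ≡⟨ cong (λ z → Σc - z) (Σℤ-*ˡ (c a) (λ n → d n * y n)) ⟩
        Σc - c a * LinComb (col ξ) d ℓ              ≡⟨ cong (λ z → Σc - c a * z) (d-rel ℓ) ⟩
        Σc - c a * 0ℤ                               ≡⟨ drop-zero Σc (c a) ⟩
        Σc                                          ≡⟨ v≡ ℓ ⟨
        v ℓ                                         ∎)
        where
        y = λ n → col ξ n ℓ
        Σc = LinComb (col ξ) c ℓ
        distrib : ∀ x z t y → (x - z * t) * y ≡ x * y - z * (t * y)
        distrib = solve-∀
        drop-zero : ∀ x z → x - z * 0ℤ ≡ x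
        drop-zero = solve-∀

    basis⇒HasRank : ∀ {A B} → B ⊆ A → LinIndepOn ξ B → (∀ {v} → InSpan ξ A v → InSpan ξ B v) →
                    HasRank (InSpan ξ A) ∣ B ∣
    basis⇒HasRank {B = B} B⊆A indep A⊆⟨B⟩ =
      independent-columns B⊆A indep ,
      λ w w∈⟨A⟩ → spanned-by-fewer⇒¬LinIndep (ℕP.n<1+n ∣ B ∣) (col ξ ∘ enum B) w
                    (λ i → InSpan⇒InSpanOf-enum (A⊆⟨B⟩ (w∈⟨A⟩ i)))

  NoIndependent : ∀ {L} → (Vecℤ L → Set) → ℕ → Set
  NoIndependent {L} G m = ∀ (w : Fin m → Vecℤ L) → (∀ i → G (w i)) → ¬ LinIndep w

  NoIndependent⇒¬LinIndepOn : ∀ {L N} (ξ : Fin L → Vecℤ N) {A} → Nonempty A →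
                               NoIndependent (InSpan ξ A) (suc (∣ A ∣ ∸ 1)) → ¬ LinIndepOn ξ A
  NoIndependent⇒¬LinIndepOn ξ {A} (_ , a∈A) no-indep indep =
    let (w , w∈⟨A⟩ , w-indep) = independent-columns ξ ⊆-refl indep
    in subst (NoIndependent (InSpan ξ A)) (x∈p⇒suc[pred∣p∣]≡∣p∣ a∈A) no-indep w w∈⟨A⟩ w-indep

  module Graph {L N} (ξ : Fin L → Vecℤ N) (ξ∈F : ∀ ℓ → InF (ξ ℓ))
               (y≢0 : ∀ n → ¬ (∀ ℓ → col ξ n ℓ ≡ 0ℤ)) where

    src tgt : Fin L → Fin N
    src ℓ = proj₁ (ξ∈F ℓ)
    tgt ℓ = proj₁ (proj₂ (ξ∈F ℓ))

    src≢tgt : ∀ ℓ → src ℓ ≢ tgt ℓ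
    src≢tgt ℓ = proj₁ (proj₂ (proj₂ (ξ∈F ℓ)))

    ξ≡e-e : ∀ ℓ k → ξ ℓ k ≡ e (src ℓ) k - e (tgt ℓ) k
    ξ≡e-e ℓ = proj₂ (proj₂ (proj₂ (ξ∈F ℓ)))

    ξ-src : ∀ ℓ → ξ ℓ (src ℓ) ≡ 1ℤ
    ξ-src ℓ = trans (ξ≡e-e ℓ (src ℓ)) (cong₂ _-_ (e-diag (src ℓ)) (e-off (src≢tgt ℓ ∘ sym)))

    ξ-tgt : ∀ ℓ → ξ ℓ (tgt ℓ) ≡ -1ℤ
    ξ-tgt ℓ = trans (ξ≡e-e ℓ (tgt ℓ)) (cong₂ _-_ (e-off (src≢tgt ℓ)) (e-diag (tgt ℓ)))

    ξ-off : ∀ {ℓ k} → k ≢ src ℓ → k ≢ tgt ℓ → ξ ℓ k ≡ 0ℤ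
    ξ-off {ℓ} {k} k≢s k≢t = trans (ξ≡e-e ℓ k) (cong₂ _-_ (e-off (k≢s ∘ sym)) (e-off (k≢t ∘ sym)))

    InS-src : ∀ ℓ → InS ξ ℓ (src ℓ)
    InS-src ℓ = cong ℤ.∣_∣ (ξ-src ℓ)

    InS-tgt : ∀ ℓ → InS ξ ℓ (tgt ℓ)
    InS-tgt ℓ = cong ℤ.∣_∣ (ξ-tgt ℓ)

    InS⇒endpoint : ∀ {ℓ k} → InS ξ ℓ k → k ≡ src ℓ ⊎ k ≡ tgt ℓ
    InS⇒endpoint {ℓ} {k} k∈S with k FinP.≟ src ℓ | k FinP.≟ tgt ℓ
    ... | yes k≡s | _       = inj₁ k≡s
    ... | no  _   | yes k≡t = inj₂ k≡t
    ... | no  k≢s | no  k≢t with trans (sym (cong ℤ.∣_∣ (ξ-off k≢s k≢t))) k∈S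
    ...   | ()

    incident-edge : ∀ k → ∃ λ ℓ → InS ξ ℓ k
    incident-edge k with FinP.any? (λ ℓ → k FinP.≟ src ℓ)
    ... | yes (ℓ , refl) = ℓ , InS-src ℓ
    ... | no  k≢srcs with FinP.any? (λ ℓ → k FinP.≟ tgt ℓ)
    ...   | yes (ℓ , refl) = ℓ , InS-tgt ℓ
    ...   | no  k≢tgts = contradiction (λ ℓ → ξ-off (λ k≡ → k≢srcs (ℓ , k≡)) (λ k≡ → k≢tgts (ℓ , k≡))) (y≢0 k)

    LinComb-col : ∀ c ℓ → LinComb (col ξ) c ℓ ≡ c (src ℓ) - c (tgt ℓ)
    LinComb-col c ℓ = begin
      Σℤ (λ k → c k * ξ ℓ k)                          ≡⟨ Σℤ-cong (λ k → cong (c k *_) (ξ≡e-e ℓ k)) ⟩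
      Σℤ (λ k → c k * (e s k - e t k))                ≡⟨ Σℤ-cong (λ k → distrib (c k) (e s k) (e t k)) ⟩
      Σℤ (λ k → c k * e s k - c k * e t k)            ≡⟨ Σℤ-- (λ k → c k * e s k) (λ k → c k * e t k) ⟩
      Σℤ (λ k → c k * e s k) - Σℤ (λ k → c k * e t k) ≡⟨ cong₂ _-_ (Σℤ-e c s) (Σℤ-e c t) ⟩
      c s - c t                                       ∎
      where
      s = src ℓ
      t = tgt ℓ
      distrib : ∀ x a b → x * (a - b) ≡ x * a - x * b
      distrib = solve-∀

    dependency⇒edge-constant : ∀ c → Dependency ξ c → ∀ ℓ → c (src ℓ) ≡ c (tgt ℓ)
    dependency⇒edge-constant c c-rel ℓ = ℤP.i-j≡0⇒i≡j _ _ (trans (sym (LinComb-col c ℓ)) (c-rel ℓ))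

    edge-constant⇒dependency : ∀ c → (∀ ℓ → c (src ℓ) ≡ c (tgt ℓ)) → Dependency ξ c
    edge-constant⇒dependency c const ℓ =
      trans (LinComb-col c ℓ) (ℤP.i≡j⇒i-j≡0 (const ℓ))

    Closed : Subset N → Set
    Closed D = ∀ ℓ → (src ℓ ∈ D → tgt ℓ ∈ D) × (tgt ℓ ∈ D → src ℓ ∈ D)

    InP⇒Closed : ∀ {D} → InP ξ D → Closed D
    InP⇒Closed η[D]≡D ℓ =
      (λ s∈D → proj₁ (η[D]≡D (tgt ℓ)) (ℓ , (src ℓ , InS-src ℓ , s∈D) , InS-tgt ℓ)) ,
      (λ t∈D → proj₁ (η[D]≡D (src ℓ)) (ℓ , (tgt ℓ , InS-tgt ℓ , t∈D) , InS-src ℓ))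

    Closed⇒InP : ∀ {D} → Closed D → InP ξ D
    Closed⇒InP {D} closed n = η[D]⊆D , D⊆η[D]
      where
      η[D]⊆D : Inη ξ D n → n ∈ D
      η[D]⊆D (ℓ , (m , m∈S , m∈D) , n∈S) with InS⇒endpoint m∈S | InS⇒endpoint n∈S
      ... | inj₁ refl | inj₁ refl = m∈D
      ... | inj₂ refl | inj₂ refl = m∈D
      ... | inj₁ refl | inj₂ refl = proj₁ (closed ℓ) m∈D
      ... | inj₂ refl | inj₁ refl = proj₂ (closed ℓ) m∈D
      D⊆η[D] : n ∈ D → Inη ξ D n
      D⊆η[D] n∈D = let (ℓ , n∈S) = incident-edge n in ℓ , (n , n∈S , n∈D) , n∈S

    Closed⇒indicator-dependency : ∀ {D} → Closed D → Dependency ξ (indicator D)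
    Closed⇒indicator-dependency {D} closed = edge-constant⇒dependency (indicator D) same-side
      where
      same-side : ∀ ℓ → indicator D (src ℓ) ≡ indicator D (tgt ℓ)
      same-side ℓ with src ℓ ∈? D
      ... | yes s∈D = sym (indicator-∈ (proj₁ (closed ℓ) s∈D))
      ... | no  s∉D = sym (indicator-∉ (s∉D ∘ proj₂ (closed ℓ)))

    level-set-closed : ∀ c → Dependency ξ c → ∀ v → Closed (level-set c v)
    level-set-closed c c-rel v ℓ =
      (λ s∈ → ∈-level-set c (trans (sym (c-const ℓ)) (level-set-∈ c s∈))) ,
      (λ t∈ → ∈-level-set c (trans (c-const ℓ) (level-set-∈ c t∈)))
      where
      c-const = dependency⇒edge-constant c c-rel

    Pinned : Subset N → Fin N → Set
    Pinned A a = ∀ D → D ⊆ A → Nonempty D → Closed D → a ∈ D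

    AllPinned : Subset N → Set
    AllPinned A = ∀ {a} → a ∈ A → Pinned A a

    -- The level set of c through a value c n ≢ 0 is a nonempty closed subset of A, so it contains a.
    Pinned⇒dependency-vanishes : ∀ {A a c} → Pinned A a → SupportedOn A c → Dependency ξ c →
                                 c a ≡ 0ℤ → ∀ n → c n ≡ 0ℤ
    Pinned⇒dependency-vanishes {A} {a} {c} pinned supp c-rel ca≡0 n with c n ℤ.≟ 0ℤ
    ... | yes cn≡0 = cn≡0
    ... | no  cn≢0 = trans (sym (level-set-∈ c a∈D)) ca≡0
      where
      D = level-set c (c n)
      D⊆A : D ⊆ A
      D⊆A {k} k∈D with k ∈? A
      ... | yes k∈A = k∈A
      ... | no  k∉A = contradiction (trans (sym (level-set-∈ c k∈D)) (supp k k∉A)) cn≢0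
      a∈D : a ∈ D
      a∈D = pinned D D⊆A (n , ∈-level-set c refl) (level-set-closed c c-rel (c n))

    Minimal⇒AllPinned : ∀ {A} → Minimal ξ A → AllPinned A
    Minimal⇒AllPinned (_ , _ , no-proper) {a} a∈A D D⊆A D≠∅ D-closed with a ∈? D
    ... | yes a∈D = a∈D
    ... | no  a∉D = contradiction (Closed⇒InP D-closed)
                      (no-proper D D⊆A D≠∅ λ D≡A → a∉D (subst (a ∈_) (sym D≡A) a∈A))

    AllPinned⇒Minimal : ∀ {A} → Nonempty A → Closed A → AllPinned A → Minimal ξ A
    AllPinned⇒Minimal {A} A≠∅ A-closed pinned = A≠∅ , Closed⇒InP A-closed , no-proper
      where
      no-proper : ∀ B → B ⊆ A → Nonempty B → B ≢ A → ¬ InP ξ B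
      no-proper B B⊆A B≠∅ B≢A η[B]≡B with ⊆⊎∃∈∧∉ A B
      ... | inj₁ A⊆B              = B≢A (⊆-antisym B⊆A A⊆B)
      ... | inj₂ (a , a∈A , a∉B) = a∉B (pinned a∈A B B⊆A B≠∅ (InP⇒Closed η[B]≡B))

    AllPinned⇒small-independent : ∀ {A} → Nonempty A → AllPinned A → ∀ B → B ⊆ A →
                                  ∣ B ∣ ≤ ∣ A ∣ ∸ 1 → LinIndepOn ξ B
    AllPinned⇒small-independent {A} (_ , a₀∈A) pinned B B⊆A ∣B∣≤ c c-supp c-rel with ⊆⊎∃∈∧∉ A B
    ... | inj₂ (a , a∈A , a∉B) =
      Pinned⇒dependency-vanishes (pinned a∈A) (λ n n∉A → c-supp n (n∉A ∘ B⊆A)) c-rel (c-supp a a∉B)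
    ... | inj₁ A⊆B = contradiction (ℕP.≤-trans (p⊆q⇒∣p∣≤∣q∣ A⊆B) ∣B∣≤)
                                   (ℕP.<⇒≱ (ℕP.≤-reflexive (x∈p⇒suc[pred∣p∣]≡∣p∣ a₀∈A)))

    Closed∧AllPinned⇒HasRank : ∀ {A} → Nonempty A → Closed A → AllPinned A →
                               HasRank (InSpan ξ A) (∣ A ∣ ∸ 1)
    Closed∧AllPinned⇒HasRank {A} A≠∅@(a₀ , a₀∈A) A-closed pinned =
      subst (HasRank (InSpan ξ A)) ∣A∖a₀∣≡pred∣A∣
        (basis⇒HasRank ξ A∖a₀⊆A
          (AllPinned⇒small-independent A≠∅ pinned (A ∖ a₀) A∖a₀⊆A (ℕP.≤-reflexive ∣A∖a₀∣≡pred∣A∣))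
          (InSpan-remove ξ (Closed⇒indicator-dependency A-closed) (λ _ → indicator-∉) (indicator-∈ a₀∈A)))
      where
      A∖a₀⊆A = p─q⊆p A ⁅ a₀ ⁆
      ∣A∖a₀∣≡pred∣A∣ = cong pred (x∈p⇒suc∣p-x∣≡∣p∣ a₀∈A)

    small-independent⇒AllPinned : ∀ {A} → (∀ B → B ⊆ A → Nonempty B → ∣ B ∣ ≤ ∣ A ∣ ∸ 1 → LinIndepOn ξ B) →
                                  AllPinned A
    small-independent⇒AllPinned small-indep {a} a∈A D D⊆A D≠∅@(d , d∈D) D-closed with a ∈? D
    ... | yes a∈D = a∈D
    ... | no  a∉D = contradiction (trans (sym (indicator-∈ d∈D)) 𝟙D[d]≡0) λ ()
      where
      𝟙D[d]≡0 = small-indep D D⊆A D≠∅ (ℕP.<⇒≤pred (p⊂q⇒∣p∣<∣q∣ (D⊆A , a , a∈A , a∉D)))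
                   (indicator D) (λ _ → indicator-∉) (Closed⇒indicator-dependency D-closed) d

    AllPinned∧¬LinIndepOn⇒Closed : ∀ {A} → AllPinned A → ¬ LinIndepOn ξ A → Closed A
    AllPinned∧¬LinIndepOn⇒Closed {A} pinned dependent ℓ =
      stays (λ c c-rel → dependency⇒edge-constant c c-rel ℓ) ,
      stays (λ c c-rel → sym (dependency⇒edge-constant c c-rel ℓ))
      where
      -- Otherwise every dependency on A vanishes at a, hence everywhere, so A would be independent.
      stays : ∀ {a b} → (∀ c → Dependency ξ c → c a ≡ c b) → a ∈ A → b ∈ A
      stays {a} {b} same a∈A with b ∈? A
      ... | yes b∈A = b∈A
      ... | no  b∉A = contradiction (λ c supp c-rel →
                        Pinned⇒dependency-vanishes (pinned a∈A) supp c-rel (trans (same c c-rel) (supp b b∉A)))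
                        dependent

open import Data.Nat using (ℕ; _<_; _≤_; _*_; _∸_)
open import Data.Integer using (0ℤ)
open import Data.Fin using (Fin)
open import Data.Fin.Subset using (Subset; Nonempty; _⊆_; ∣_∣)
open import Data.Product using (_×_; _,_; proj₁; proj₂)
open import Relation.Binary.PropositionalEquality using (_≡_)
open import Relation.Nullary using (¬_)
open import Function.Bundles using (_⇔_; mk⇔)
open Incidence

lemma3p7 : (L N : ℕ) → 0 < L → L < N → N ≤ 2 * L →
    (ξ : Fin L → Vecℤ N) → (∀ ℓ → InF (ξ ℓ)) →
    (∀ n → ¬ (∀ ℓ → col ξ n ℓ ≡ 0ℤ)) →
    (A : Subset N) → Nonempty A →
    Minimal ξ A ⇔
      (HasRank (InSpan ξ A) (∣ A ∣ ∸ 1) ×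
       (∀ B → B ⊆ A → Nonempty B → ∣ B ∣ ≤ ∣ A ∣ ∸ 1 → LinIndepOn ξ B))
lemma3p7 L N _ _ _ ξ ξ∈F y≢0 A A≠∅ = mk⇔
  (λ minimal →
     let pinned = Minimal⇒AllPinned minimal in
     Closed∧AllPinned⇒HasRank A≠∅ (InP⇒Closed (proj₁ (proj₂ minimal))) pinned ,
     λ B (B⊆A : B ⊆ A) _ → AllPinned⇒small-independent A≠∅ pinned B B⊆A)
  (λ (rank , small-indep) →
     let pinned = small-independent⇒AllPinned small-indep in
     AllPinned⇒Minimal A≠∅ (AllPinned∧¬LinIndepOn⇒Closed pinned (NoIndependent⇒¬LinIndepOn ξ A≠∅ (proj₂ rank)))
                       pinned)
  where open Graph ξ ξ∈F y≢0
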